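{- Let $T$ be a tree, $e\in E(\overline{T})$, and let $C$ be the unique cycle of the unicyclic graph $T+e$. For each vertex $w\in V(C)$, let $T_w$ denote the subtree rooted at $w$, i.e., the connected component of $(T+e)-E(C)$ containing $w$. Let $u_0,v_0,\theta_0$ be three distinct vertices of $C$ with $d(u_0,v_0)=\operatorname{diam}(C)$, and let $u\in V(T_{u_0})$, $v\in V(T_{v_0})$, $\theta\in V(T_{\theta_0})$. Set $B_0=\{u,v,\theta\}$. Then for any vertices $x,y$ lying in distinct subtrees $T_w\ne T_{w'}$ ($w,w'\in V(C)$), the metric codes of $x$ and $y$ with respect to $B_0$ differ, i.e., $(d(x,u),d(x,v),d(x,\theta))\ne(d(y,u),d(y,v),d(y,\theta))$.
   Context: All distances $d$ are shortest-path distances in $T+e$. $\operatorname{diam}(C)$ is the largest distance between two vertices of the cycle $C$ (equal to $\lfloor |V(C)|/2\rfloor$). For an ordered set $W=\{w_1,\dots,w_k\}$, the metric code of a vertex $x$ is $(d(x,w_1),\dots,d(x,w_k))$. -}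

module Defs where

open import Data.Nat using (ℕ; zero; suc; _<_; _≤_; ⌊_/2⌋)
open import Data.Nat.DivMod using (_mod_)
open import Data.Fin using (Fin; toℕ)
open import Data.Product using (Σ; ∃; _×_; _,_)
open import Data.Sum using (_⊎_)
open import Data.Empty using (⊥)
open import Relation.Nullary using (¬_)
open import Relation.Binary.PropositionalEquality using (_≡_; _≢_)
open import Function.Definitions using (Injective)

Graph : ℕ → Set₁
Graph n = Fin n → Fin n → Set

record IsSimple {n : ℕ} (G : Graph n) : Set where
  field
    sym   : ∀ {x y} → G x y → G y x
    irrefl : ∀ {x} → ¬ G x x

data Walk {n : ℕ} (G : Graph n) : Fin n → Fin n → ℕ → Set where
  here : ∀ {x} → Walk G x x 0
  step : ∀ {x z y k} → G x z → Walk G z y k → Walk G x y (suc k)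

Reach : {n : ℕ} → Graph n → Fin n → Fin n → Set
Reach G x y = ∃ λ k → Walk G x y k

Dist : {n : ℕ} → Graph n → Fin n → Fin n → ℕ → Set
Dist G x y k = Walk G x y k × (∀ m → m < k → ¬ Walk G x y m)

Connected : {n : ℕ} → Graph n → Set
Connected G = ∀ x y → Reach G x y

next : {m : ℕ} → Fin (suc m) → Fin (suc m)
next {m} i = suc (toℕ i) mod (suc m)

-- c : Fin (suc m) → Fin n is a cycle c₀ c₁ … c_m c₀ of G of length suc m ≥ 3
record IsCycle {n : ℕ} (G : Graph n) (m : ℕ) (c : Fin (suc m) → Fin n) : Set where
  field
    long : 2 ≤ m
    inj  : Injective _≡_ _≡_ c
    adj  : ∀ i → G (c i) (c (next i))

Acyclic : {n : ℕ} → Graph n → Set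
Acyclic G = ∀ m c → ¬ IsCycle G m c

record IsTree {n : ℕ} (T : Graph n) : Set where
  field
    simple    : IsSimple T
    connected : Connected T
    acyclic   : Acyclic T

AddEdge : {n : ℕ} → Graph n → Fin n → Fin n → Graph n
AddEdge T a b x y = T x y ⊎ ((x ≡ a × y ≡ b) ⊎ (x ≡ b × y ≡ a))

OnCycle : {n m : ℕ} → (Fin (suc m) → Fin n) → Fin n → Set
OnCycle c w = ∃ λ i → c i ≡ w

CycleEdge : {n m : ℕ} → (Fin (suc m) → Fin n) → Fin n → Fin n → Set
CycleEdge c x y = ∃ λ i → (c i ≡ x × c (next i) ≡ y) ⊎ (c i ≡ y × c (next i) ≡ x)

RemoveCycleEdges : {n m : ℕ} → Graph n → (Fin (suc m) → Fin n) → Graph n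
RemoveCycleEdges G c x y = G x y × ¬ CycleEdge c x y

-- x ∈ V(T_w): x in the component of G − E(C) containing w
InSubtree : {n m : ℕ} → Graph n → (Fin (suc m) → Fin n) → Fin n → Fin n → Set
InSubtree G c w x = Reach (RemoveCycleEdges G c) w x

diamC : ℕ → ℕ
diamC m = ⌊ suc m /2⌋

module Submission where

-- Write L = |V(C)| = suc m and D = ⌊ L /2⌋.  Every vertex x of T + e hangs
-- from a unique cycle vertex (the hanging subtrees of distinct cycle
-- vertices are disjoint, since a walk joining two of them outside E(C)
-- would close a cycle in T).  Hence, for x above cycle index i at height hx
-- and a landmark s above index l at height hs, the distance d(x, s) equals
-- hx + cyc(i, l) + hs when i ≢ l and is at most hx + hs when i ≡ l, where
-- cyc is the distance along the cycle.  The theorem thus reduces to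
-- arithmetic on the cycle: if x and y (above i ≢ j) had equal codes, then
-- either one of them hangs from a landmark root, which contradicts the
-- antipodality d(u₀, v₀) = D, or the equations hx + cyc(i, ·) = hy + cyc(j, ·)
-- hold at all three roots; after moving u₀, v₀ to positions 0, D by a
-- symmetry of the cycle these are refuted by parity (L odd) or because only
-- mirror images in the axis u₀v₀ agree on u₀, v₀, and θ₀ lies off that axis.

open import Defs
open import Data.Nat
  using (ℕ; zero; suc; _+_; _*_; _∸_; _≤_; _<_; z≤n; s≤s; s≤s⁻¹; _<?_; _≤?_;
         ∣_-_∣; _⊓_; _%_; ⌊_/2⌋)
open import Data.Nat.Properties
open import Data.Nat.Induction using (<-rec)
open import Data.Nat.DivMod using (m<n⇒m%n≡m; n%n≡0)
open import Data.Nat.Tactic.RingSolver using (solve-∀)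
open import Data.Fin using (Fin; zero; toℕ; fromℕ; opposite) renaming (_≟_ to _≟ᶠ_)
open import Data.Fin.Properties
  using (toℕ-fromℕ<; toℕ-injective; toℕ<n; toℕ-fromℕ; opposite-prop; any?)
open import Data.Product using (∃; _×_; _,_; proj₁; proj₂)
open import Data.Sum using (_⊎_; inj₁; inj₂)
open import Data.Empty using (⊥; ⊥-elim)
open import Relation.Nullary using (¬_; Dec; yes; no)
open import Relation.Nullary.Decidable using (_×-dec_; _⊎-dec_)
open import Relation.Binary.PropositionalEquality
open import Relation.Binary.Definitions using (tri<; tri≈; tri>)

refute-minimal : (P : ℕ → Set) {l : ℕ} → P l →
                 (∀ k → P k → (∀ k′ → k′ < k → ¬ P k′) → ⊥) → ⊥
refute-minimal P {l} pl κ =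
  <-rec (λ k → ¬ P k) (λ k smaller pk → κ k pk (λ _ lt → smaller lt)) l pl

module WalkOps {n : ℕ} {G : Graph n} where

  infixr 5 _++ʷ_

  _++ʷ_ : ∀ {x y z k l} → Walk G x y k → Walk G y z l → Walk G x z (k + l)
  here       ++ʷ q = q
  step g p   ++ʷ q = step g (p ++ʷ q)

  reverse-onto : (∀ {x y} → G x y → G y x) →
                 ∀ {x y z k l} → Walk G x y k → Walk G x z l → Walk G y z (k + l)
  reverse-onto sym here acc = acc
  reverse-onto sym {k = suc k} {l} (step g p) acc =
    subst (Walk G _ _) (+-suc k l) (reverse-onto sym p (step (sym g) acc))

  reverseʷ : (∀ {x y} → G x y → G y x) → ∀ {x y k} → Walk G x y k → Walk G y x k
  reverseʷ sym {k = k} p = subst (Walk G _ _) (+-identityʳ k) (reverse-onto sym p here)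

  mapʷ : ∀ {G′ : Graph n} → (∀ {x y} → G x y → G′ x y) →
         ∀ {x y k} → Walk G x y k → Walk G′ x y k
  mapʷ f here       = here
  mapʷ f (step g w) = step (f g) (mapʷ f w)

  -- The j-th vertex of a walk (the endpoint once j exceeds the length).
  vertexAt : ∀ {x y k} → Walk G x y k → ℕ → Fin n
  vertexAt {x} w          zero    = x
  vertexAt {x} here       (suc j) = x
  vertexAt     (step g w) (suc j) = vertexAt w j

  vertexAt-adjacent : ∀ {x y k} (w : Walk G x y k) j → j < k →
                      G (vertexAt w j) (vertexAt w (suc j))
  vertexAt-adjacent (step g here)       zero    _         = g
  vertexAt-adjacent (step g (step h w)) zero    _         = g
  vertexAt-adjacent (step g w)          (suc j) (s≤s j<k) = vertexAt-adjacent w j j<k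

  vertexAt-end : ∀ {x y k} (w : Walk G x y k) → vertexAt w k ≡ y
  vertexAt-end here       = refl
  vertexAt-end (step g w) = vertexAt-end w

  takeʷ : ∀ {x y k} (w : Walk G x y k) j → j ≤ k → Walk G x (vertexAt w j) j
  takeʷ w          zero    _         = here
  takeʷ (step g w) (suc j) (s≤s j≤k) = step g (takeʷ w j j≤k)

  dropʷ : ∀ {x y k} (w : Walk G x y k) j → j ≤ k → Walk G (vertexAt w j) y (k ∸ j)
  dropʷ w          zero    _         = w
  dropʷ (step g w) (suc j) (s≤s j≤k) = dropʷ w j j≤k

  dist-minimal : ∀ {x y k l} → Dist G x y k → Walk G x y l → k ≤ l
  dist-minimal (_ , shortest) w = ≮⇒≥ λ l<k → shortest _ l<k w

  dist-unique : ∀ {x y k l} → Dist G x y k → Dist G x y l → k ≡ l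
  dist-unique d₁ d₂ = ≤-antisym (dist-minimal d₁ (proj₁ d₂)) (dist-minimal d₂ (proj₁ d₁))

  -- Connected vertices have a distance (usable when proving a negation).
  refute-with-dist : ∀ {x y l} → Walk G x y l → (∀ k → Dist G x y k → ⊥) → ⊥
  refute-with-dist {x} {y} w κ =
    refute-minimal (Walk G x y) w λ k wk shorter → κ k (wk , shorter)

cdist : ℕ → ℕ → ℕ → ℕ
cdist L i j = ∣ i - j ∣ ⊓ (L ∸ ∣ i - j ∣)

cdist-sym : ∀ L i j → cdist L i j ≡ cdist L j i
cdist-sym L i j = cong (λ d → d ⊓ (L ∸ d)) (∣-∣-comm i j)

cdist-forward : ∀ L i d → cdist L i (i + d) ≡ d ⊓ (L ∸ d)
cdist-forward L i d = cong (λ k → k ⊓ (L ∸ k)) (∣m-m+n∣≡n i d)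

cdist-arcs : ∀ L i d e → d + e ≡ L → cdist L i (i + d) ≡ d ⊓ e
cdist-arcs L i d e d+e≡L =
  trans (cdist-forward L i d) (cong (d ⊓_) (trans (cong (_∸ d) (sym d+e≡L)) (m+n∸m≡n d e)))

cdist-short : ∀ L i d → d + d ≤ L → cdist L i (i + d) ≡ d
cdist-short L i d d+d≤L = trans (cdist-forward L i d) (m≤n⇒m⊓n≡m (m+n≤o⇒m≤o∸n d d+d≤L))

∣-∣-reflect : ∀ M i j → i ≤ M → j ≤ M → ∣ (M ∸ i) - (M ∸ j) ∣ ≡ ∣ i - j ∣
∣-∣-reflect M       zero    j       _         j≤M       =
  trans (m≤n⇒∣n-m∣≡n∸m (m∸n≤m M j)) (m∸[m∸n]≡n j≤M)
∣-∣-reflect M       (suc i) zero    i≤M       _         =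
  trans (m≤n⇒∣m-n∣≡n∸m (m∸n≤m M (suc i))) (m∸[m∸n]≡n i≤M)
∣-∣-reflect (suc M) (suc i) (suc j) (s≤s i≤M) (s≤s j≤M) = ∣-∣-reflect M i j i≤M j≤M

cdist-reflect : ∀ L M i j → i ≤ M → j ≤ M → cdist L (M ∸ i) (M ∸ j) ≡ cdist L i j
cdist-reflect L M i j i≤M j≤M = cong (λ d → d ⊓ (L ∸ d)) (∣-∣-reflect M i j i≤M j≤M)

cdist-suc : ∀ L i j → cdist L (suc i) j ≤ suc (cdist L i j) × cdist L i j ≤ suc (cdist L (suc i) j)
cdist-suc L i j = ⊓-mono-≤ up (co-Lipschitz down) , ⊓-mono-≤ down (co-Lipschitz up)
  where
  ∣-∣-suc : ∀ i j → ∣ suc i - j ∣ ≤ suc ∣ i - j ∣ × ∣ i - j ∣ ≤ suc ∣ suc i - j ∣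
  ∣-∣-suc zero    zero    = ≤-refl , z≤n
  ∣-∣-suc (suc i) zero    = ≤-refl , m≤n⇒m≤1+n (n≤1+n (suc i))
  ∣-∣-suc zero    (suc j) = m≤n⇒m≤1+n (n≤1+n j) , ≤-refl
  ∣-∣-suc (suc i) (suc j) = ∣-∣-suc i j
  up   = proj₁ (∣-∣-suc i j)
  down = proj₂ (∣-∣-suc i j)
  suc-∸ : ∀ M y → suc M ∸ y ≤ suc (M ∸ y)
  suc-∸ M       zero    = ≤-refl
  suc-∸ zero    (suc y) = subst (_≤ 1) (sym (0∸n≡0 y)) z≤n
  suc-∸ (suc M) (suc y) = suc-∸ M y
  co-Lipschitz : ∀ {x y} → y ≤ suc x → L ∸ x ≤ suc (L ∸ y)
  co-Lipschitz {x} {y} y≤1+x = ≤-trans (∸-monoʳ-≤ (suc L) y≤1+x) (suc-∸ L y)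

≤1-cases : ∀ {e} → e ≤ 1 → e ≡ 0 ⊎ e ≡ 1
≤1-cases z≤n       = inj₁ refl
≤1-cases (s≤s z≤n) = inj₂ refl

halves : ∀ L → ∃ λ ε → ε ≤ 1 × L ≡ ⌊ L /2⌋ + ⌊ L /2⌋ + ε
halves zero          = 0 , z≤n , refl
halves (suc zero)    = 1 , ≤-refl , refl
halves (suc (suc L)) with halves L
... | ε , ε≤1 , L≡ = ε , ε≤1 , trans (cong (λ k → suc (suc k)) L≡)
                                     (cong (λ k → suc k + ε) (sym (+-suc ⌊ L /2⌋ ⌊ L /2⌋)))

∸-from-sum : ∀ a {b c} → a + b ≡ c → c ∸ a ≡ b
∸-from-sum a {b} a+b≡c = trans (cong (_∸ a) (sym a+b≡c)) (m+n∸m≡n a b)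

add-equations : ∀ hx hy {a a′ b b′} → hx + a ≡ hy + a′ → hx + b ≡ hy + b′ →
                (hx + hx) + (a + b) ≡ (hy + hy) + (a′ + b′)
add-equations hx hy {a} {a′} {b} {b′} e₁ e₂ =
  trans (sym (rearrange hx a b)) (trans (cong₂ _+_ e₁ e₂) (rearrange hy a′ b′))
  where
  rearrange : ∀ h a b → (h + a) + (h + b) ≡ (h + h) + (a + b)
  rearrange = solve-∀

equal-offsets : ∀ hx hy {a a′ b b′} → hx + a ≡ hy + a′ → hx + b ≡ hy + b′ →
                a + b ≡ a′ + b′ → hx ≡ hy
equal-offsets hx hy {a} {a′} {b} {b′} e₁ e₂ sums =
  trans (n≡⌊n+n/2⌋ hx) (trans (cong ⌊_/2⌋ doubles) (sym (n≡⌊n+n/2⌋ hy)))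
  where
  doubles : hx + hx ≡ hy + hy
  doubles = +-cancelʳ-≡ (a′ + b′) (hx + hx) (hy + hy)
              (trans (cong (hx + hx +_) (sym sums)) (add-equations hx hy e₁ e₂))

offset-parity : ∀ hx hy {a a′ b b′ K} → hx + a ≡ hy + a′ → hx + b ≡ hy + b′ →
                a + b ≡ K → a′ + b′ ≡ suc K → ⊥
offset-parity hx hy {a} {a′} {b} {b′} {K} e₁ e₂ s s′ = even≢odd hx hy (+-cancelʳ-≡ K _ _ eq)
  where
  twice : ∀ h → 2 * h ≡ h + h
  twice h = cong (h +_) (+-identityʳ h)
  eq : 2 * hx + K ≡ suc (2 * hy) + K
  eq = trans (cong₂ _+_ (twice hx) (sym s))
       (trans (add-equations hx hy e₁ e₂) (trans (cong₂ _+_ (sym (twice hy)) s′) (+-suc (2 * hy) K)))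

-- Positions on a cycle of length L = D + D + ε (ε ≤ 1), seen from two
-- antipodal landmarks at positions 0 and D.
module AntipodalFrame (D ε : ℕ) (ε≤1 : ε ≤ 1) (L : ℕ) (L≡ : L ≡ D + D + ε) where

  D+D≤L : D + D ≤ L
  D+D≤L = subst (D + D ≤_) (sym L≡) (m≤m+n (D + D) ε)

  L-even : ε ≡ 0 → L ≡ D + D
  L-even ε≡0 = trans L≡ (trans (cong (D + D +_) ε≡0) (+-identityʳ (D + D)))

  part≤D : ∀ {a b} → a + b ≡ D + ε → 1 ≤ b → a ≤ D
  part≤D {a} {b} a+b≡ 1≤b = +-cancelʳ-≤ 1 a D
    (≤-trans (+-monoʳ-≤ a 1≤b) (subst (_≤ D + 1) (sym a+b≡) (+-monoʳ-≤ D ε≤1)))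

  record OnUpperArc (t : ℕ) : Set where
    field
      rest     : ℕ
      t+rest≡D : t + rest ≡ D
      to-0     : cdist L t 0 ≡ t
      to-D     : cdist L t D ≡ rest

  upper-arc : ∀ t → t ≤ D → OnUpperArc t
  upper-arc t t≤D = record
    { rest = rest ; t+rest≡D = t+rest≡D
    ; to-0 = trans (cdist-sym L t 0) (cdist-short L 0 t (≤-trans (+-mono-≤ t≤D t≤D) D+D≤L))
    ; to-D = trans (cong (cdist L t) (sym t+rest≡D))
                   (cdist-short L t rest (≤-trans (+-mono-≤ rest≤D rest≤D) D+D≤L))
    }
    where
    rest = D ∸ t
    t+rest≡D = m+[n∸m]≡n t≤D
    rest≤D = m∸n≤m D t

  record OnLowerArc (t : ℕ) : Set where
    field
      past          : ℕ
      back          : ℕ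
      past≥1        : 1 ≤ past
      t≡D+past      : t ≡ D + past
      back+past≡D+ε : back + past ≡ D + ε
      to-0          : cdist L t 0 ≡ back
      to-D          : cdist L t D ≡ past

  lower-arc : ∀ t → D < t → t < L → OnLowerArc t
  lower-arc t D<t t<L = record
    { past = past ; back = back ; past≥1 = m<n⇒0<n∸m D<t ; t≡D+past = t≡D+past
    ; back+past≡D+ε = back+past≡D+ε
    ; to-0 = trans (cdist-sym L t 0) (trans (cdist-arcs L 0 t back t+back≡L) (m≥n⇒m⊓n≡n back≤t))
    ; to-D = trans (cdist-sym L t D) (trans (cong (cdist L D) t≡D+past)
                   (cdist-short L D past (≤-trans (+-mono-≤ past≤D past≤D) D+D≤L)))
    }
    where
    past = t ∸ D
    back = L ∸ t
    t≡D+past = sym (m+[n∸m]≡n (<⇒≤ D<t))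
    t+back≡L = m+[n∸m]≡n (<⇒≤ t<L)
    back+past≡D+ε : back + past ≡ D + ε
    back+past≡D+ε = +-cancelˡ-≡ D _ _ (begin
      D + (back + past)  ≡⟨ cong (D +_) (+-comm back past) ⟩
      D + (past + back)  ≡⟨ sym (+-assoc D past back) ⟩
      (D + past) + back  ≡⟨ cong (_+ back) (sym t≡D+past) ⟩
      t + back           ≡⟨ t+back≡L ⟩
      L                  ≡⟨ trans L≡ (+-assoc D D ε) ⟩
      D + (D + ε)        ∎)
      where open ≡-Reasoning
    back≤t : back ≤ t
    back≤t = ≤-trans (part≤D back+past≡D+ε (m<n⇒0<n∸m D<t)) (<⇒≤ D<t)
    past≤D : past ≤ D
    past≤D = part≤D (trans (+-comm past back) back+past≡D+ε) (m<n⇒0<n∸m t<L)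

  landmark-sum : ∀ t → t < L → cdist L t 0 + cdist L t D ≤ suc D
  landmark-sum t t<L with t ≤? D
  ... | yes t≤D = subst (_≤ suc D) (sym (trans (cong₂ _+_ to-0 to-D) t+rest≡D)) (n≤1+n D)
    where open OnUpperArc (upper-arc t t≤D)
  ... | no  t≰D = subst (_≤ suc D) (sym (trans (cong₂ _+_ to-0 to-D) back+past≡D+ε))
                        (subst (D + ε ≤_) (+-comm D 1) (+-monoʳ-≤ D ε≤1))
    where open OnLowerArc (lower-arc t (≰⇒> t≰D) t<L)

  -- For 0 < x, p < D the distance δ from x to p is shorter than both arcs
  -- (of lengths q + r and p + x, where p + q = D) joining p to the mirror
  -- image D + r of x = D ∸ r.
  private
    near-distance : ∀ x r p q → x + r ≡ D → p + q ≡ D → 1 ≤ x → 1 ≤ r → 1 ≤ p → 1 ≤ q →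
                    ∃ λ δ → cdist L x p ≡ δ × δ < q + r × δ < p + x
    near-distance x r p q x+r≡D p+q≡D 1≤x 1≤r 1≤p 1≤q with x ≤? p
    ... | yes x≤p = δ , to-p , δ<q+r , δ<p+x
      where
      δ = p ∸ x
      p≡x+δ = sym (m+[n∸m]≡n x≤p)
      δ≤D = ≤-trans (m∸n≤m p x) (subst (p ≤_) p+q≡D (m≤m+n p q))
      to-p : cdist L x p ≡ δ
      to-p = trans (cong (cdist L x) p≡x+δ) (cdist-short L x δ (≤-trans (+-mono-≤ δ≤D δ≤D) D+D≤L))
      r≡δ+q : r ≡ δ + q
      r≡δ+q = +-cancelˡ-≡ x _ _ (trans x+r≡D (trans (sym p+q≡D) (trans (cong (_+ q) p≡x+δ) (+-assoc x δ q))))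
      δ<q+r : δ < q + r
      δ<q+r = subst (δ <_) (sym (trans (cong (q +_) r≡δ+q) (+-comm q (δ + q))))
                    (≤-trans (m<m+n δ 1≤q) (m≤m+n (δ + q) q))
      δ<p+x : δ < p + x
      δ<p+x = <-≤-trans (m<m+n δ 1≤x) (+-monoˡ-≤ x (m∸n≤m p x))
    ... | no x≰p = δ , to-p , δ<q+r , δ<p+x
      where
      δ = x ∸ p
      x≡p+δ = sym (m+[n∸m]≡n (<⇒≤ (≰⇒> x≰p)))
      δ≤D = ≤-trans (m∸n≤m x p) (subst (x ≤_) x+r≡D (m≤m+n x r))
      to-p : cdist L x p ≡ δ
      to-p = trans (cdist-sym L x p)
                   (trans (cong (cdist L p) x≡p+δ) (cdist-short L p δ (≤-trans (+-mono-≤ δ≤D δ≤D) D+D≤L)))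
      q≡δ+r : q ≡ δ + r
      q≡δ+r = +-cancelˡ-≡ p _ _ (trans p+q≡D (trans (sym x+r≡D) (trans (cong (_+ r) x≡p+δ) (+-assoc p δ r))))
      δ<q+r : δ < q + r
      δ<q+r = ≤-trans (subst (δ <_) (sym q≡δ+r) (m<m+n δ 1≤r)) (m≤m+n q r)
      δ<p+x : δ < p + x
      δ<p+x = ≤-<-trans (m∸n≤m x p) (m<n+m x 1≤p)

  -- On an even cycle (L = D + D) the mirror images x and D + r = L ∸ x of a
  -- position 0 < x < D are distinguished by every position 0 < p < D …
  mirror-separated-upper : ε ≡ 0 → ∀ x r p → x + r ≡ D → 1 ≤ x → 1 ≤ r → 1 ≤ p → p < D →
                           cdist L x p ≢ cdist L (D + r) p
  mirror-separated-upper ε≡0 x r p x+r≡D 1≤x 1≤r 1≤p p<D eq =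
    <-irrefl (trans (sym x-to-p) (trans eq mirror-to-p)) (⊓-glb δ<q+r δ<p+x)
    where
    q = D ∸ p
    p+q≡D = m+[n∸m]≡n (<⇒≤ p<D)
    near = near-distance x r p q x+r≡D p+q≡D 1≤x 1≤r 1≤p (m<n⇒0<n∸m p<D)
    δ = proj₁ near
    x-to-p = proj₁ (proj₂ near)
    δ<q+r = proj₁ (proj₂ (proj₂ near))
    δ<p+x = proj₂ (proj₂ (proj₂ near))
    arcs : (q + r) + (p + x) ≡ L
    arcs = begin
      (q + r) + (p + x)  ≡⟨ rearrange q r p x ⟩
      (p + q) + (x + r)  ≡⟨ cong₂ _+_ p+q≡D x+r≡D ⟩
      D + D              ≡⟨ sym (L-even ε≡0) ⟩
      L                  ∎
      where
      open ≡-Reasoning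
      rearrange : ∀ q r p x → (q + r) + (p + x) ≡ (p + q) + (x + r)
      rearrange = solve-∀
    mirror-to-p : cdist L (D + r) p ≡ (q + r) ⊓ (p + x)
    mirror-to-p = trans (cdist-sym L (D + r) p)
                   (trans (cong (λ k → cdist L p (k + r)) (sym p+q≡D))
                   (trans (cong (cdist L p) (+-assoc p q r)) (cdist-arcs L p (q + r) (p + x) arcs)))

  -- … and hence, by the reflection t ↦ L ∸ t, by every position p ∉ {0, D}.
  mirror-separated : ε ≡ 0 → ∀ x r p → x + r ≡ D → 1 ≤ x → 1 ≤ r → 1 ≤ p → p < L → p ≢ D →
                     cdist L x p ≢ cdist L (D + r) p
  mirror-separated ε≡0 x r p x+r≡D 1≤x 1≤r 1≤p p<L p≢D eq with <-cmp p D
  ... | tri< p<D _ _ = mirror-separated-upper ε≡0 x r p x+r≡D 1≤x 1≤r 1≤p p<D eq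
  ... | tri≈ _ p≡D _ = p≢D p≡D
  ... | tri> _ _ D<p = mirror-separated-upper ε≡0 x r p′ x+r≡D 1≤x 1≤r (m<n⇒0<n∸m p<L) p′<D
                         (trans (sym (reflected (D + r) x L∸[D+r] D+r≤L))
                         (trans (sym eq) (reflected x (D + r) L∸x x≤L)))
    where
    L≡D+D = L-even ε≡0
    p′ = L ∸ p
    p′<D : p′ < D
    p′<D = +-cancelˡ-< D p′ D (subst (D + p′ <_) L≡D+D
             (subst (D + p′ <_) (m+[n∸m]≡n (<⇒≤ p<L)) (+-monoˡ-< p′ D<p)))
    mirror+x≡L : (D + r) + x ≡ L
    mirror+x≡L = trans (+-assoc D r x) (trans (cong (D +_) (trans (+-comm r x) x+r≡D)) (sym L≡D+D))
    x+mirror≡L : x + (D + r) ≡ L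
    x+mirror≡L = trans (+-comm x (D + r)) mirror+x≡L
    L∸x = ∸-from-sum x x+mirror≡L
    L∸[D+r] = ∸-from-sum (D + r) mirror+x≡L
    x≤L = subst (x ≤_) x+mirror≡L (m≤m+n x (D + r))
    D+r≤L = subst (D + r ≤_) mirror+x≡L (m≤m+n (D + r) x)
    reflected : ∀ a a′ → L ∸ a ≡ a′ → a ≤ L → cdist L a p ≡ cdist L a′ p′
    reflected a a′ L∸a≡a′ a≤L =
      trans (sym (cdist-reflect L L a p a≤L (<⇒≤ p<L))) (cong (λ k → cdist L k p′) L∸a≡a′)

  -- Landmark ℓ does not tell apart two vertices at heights hx and hy above
  -- the positions ti and tj of the cycle.
  Agree : ℕ → ℕ → ℕ → ℕ → ℕ → Set
  Agree hx hy ti tj ℓ = hx + cdist L ti ℓ ≡ hy + cdist L tj ℓ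

  -- Positions on opposite arcs are told apart by 0, D and one more position:
  -- on an odd cycle already by parity, on an even one because the only
  -- candidates are mirror images, which the third landmark separates.
  opposite-arcs : ∀ ti tj p hx hy → ti ≤ D → D < tj → tj < L → 1 ≤ ti → ti ≢ D →
                  1 ≤ p → p < L → p ≢ D →
                  Agree hx hy ti tj 0 → Agree hx hy ti tj D → Agree hx hy ti tj p → ⊥
  opposite-arcs ti tj p hx hy ti≤D D<tj tj<L 1≤ti ti≢D 1≤p p<L p≢D a₀ a_D a_p = by-parity (≤1-cases ε≤1)
    where
    module U = OnUpperArc (upper-arc ti ti≤D)
    module W = OnLowerArc (lower-arc tj D<tj tj<L)
    e₀ : hx + ti ≡ hy + W.back
    e₀ = trans (cong (hx +_) (sym U.to-0)) (trans a₀ (cong (hy +_) W.to-0))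
    e_D : hx + U.rest ≡ hy + W.past
    e_D = trans (cong (hx +_) (sym U.to-D)) (trans a_D (cong (hy +_) W.to-D))
    by-parity : ε ≡ 0 ⊎ ε ≡ 1 → ⊥
    by-parity (inj₂ ε≡1) = offset-parity hx hy e₀ e_D U.t+rest≡D
                             (trans W.back+past≡D+ε (trans (cong (D +_) ε≡1) (+-comm D 1)))
    by-parity (inj₁ ε≡0) = mirror-separated ε≡0 ti U.rest p U.t+rest≡D 1≤ti 1≤rest 1≤p p<L p≢D
                             (+-cancelˡ-≡ hx _ _ (a_p ∙ cong₂ (λ h k → h + cdist L k p) (sym hx≡hy) tj≡mirror))
      where
      _∙_ = trans
      -- both sums of landmark distances are D, so the heights agree …
      hx≡hy : hx ≡ hy
      hx≡hy = equal-offsets hx hy e₀ e_D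
                (U.t+rest≡D ∙ sym (W.back+past≡D+ε ∙ (cong (D +_) ε≡0 ∙ +-identityʳ D)))
      -- … and then so do the distances to D: tj is the mirror image of ti
      tj≡mirror : tj ≡ D + U.rest
      tj≡mirror = W.t≡D+past ∙ cong (D +_) (sym (+-cancelˡ-≡ hx _ _ (e_D ∙ cong (_+ W.past) (sym hx≡hy))))
      1≤rest : 1 ≤ U.rest
      1≤rest = n≢0⇒n>0 λ rest≡0 →
                 ti≢D (sym (+-identityʳ ti) ∙ (cong (ti +_) (sym rest≡0) ∙ U.t+rest≡D))

  resolving : ∀ ti tj p hx hy → ti < L → tj < L → p < L →
              1 ≤ ti → ti ≢ D → 1 ≤ tj → tj ≢ D → ti ≢ tj → 1 ≤ p → p ≢ D →
              Agree hx hy ti tj 0 → Agree hx hy ti tj D → Agree hx hy ti tj p → ⊥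
  resolving ti tj p hx hy ti<L tj<L p<L 1≤ti ti≢D 1≤tj tj≢D ti≢tj 1≤p p≢D a₀ a_D a_p
    with ti ≤? D | tj ≤? D
  ... | yes ti≤D | no tj≰D =
    opposite-arcs ti tj p hx hy ti≤D (≰⇒> tj≰D) tj<L 1≤ti ti≢D 1≤p p<L p≢D a₀ a_D a_p
  ... | no ti≰D | yes tj≤D =
    opposite-arcs tj ti p hy hx tj≤D (≰⇒> ti≰D) ti<L 1≤tj tj≢D 1≤p p<L p≢D (sym a₀) (sym a_D) (sym a_p)
  ... | yes ti≤D | yes tj≤D = ti≢tj (+-cancelˡ-≡ hx _ _ (trans e₀ (cong (_+ tj) (sym hx≡hy))))
    where
    -- on the upper arc the distance to 0 is the position itself
    module I = OnUpperArc (upper-arc ti ti≤D)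
    module J = OnUpperArc (upper-arc tj tj≤D)
    e₀ = trans (cong (hx +_) (sym I.to-0)) (trans a₀ (cong (hy +_) J.to-0))
    e_D = trans (cong (hx +_) (sym I.to-D)) (trans a_D (cong (hy +_) J.to-D))
    hx≡hy = equal-offsets hx hy e₀ e_D (trans I.t+rest≡D (sym J.t+rest≡D))
  ... | no ti≰D | no tj≰D = ti≢tj (trans I.t≡D+past (trans (cong (D +_) past≡) (sym J.t≡D+past)))
    where
    -- on the lower arc the distance to D determines the position
    module I = OnLowerArc (lower-arc ti (≰⇒> ti≰D) ti<L)
    module J = OnLowerArc (lower-arc tj (≰⇒> tj≰D) tj<L)
    e₀ = trans (cong (hx +_) (sym I.to-0)) (trans a₀ (cong (hy +_) J.to-0))
    e_D = trans (cong (hx +_) (sym I.to-D)) (trans a_D (cong (hy +_) J.to-D))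
    hx≡hy = equal-offsets hx hy e₀ e_D (trans I.back+past≡D+ε (sym J.back+past≡D+ε))
    past≡ = +-cancelˡ-≡ hx _ _ (trans e_D (cong (_+ J.past) (sym hx≡hy)))

module CycleIndex (m : ℕ) where

  L : ℕ
  L = suc m

  toℕ≤m : (i : Fin L) → toℕ i ≤ m
  toℕ≤m i = s≤s⁻¹ (toℕ<n i)

  next-step : ∀ i → toℕ i < m → toℕ (next {m} i) ≡ suc (toℕ i)
  next-step i i<m = trans (toℕ-fromℕ< _) (m<n⇒m%n≡m (s≤s i<m))

  next-wrap : ∀ i → toℕ i ≡ m → toℕ (next {m} i) ≡ 0
  next-wrap i i≡m = trans (toℕ-fromℕ< _) (trans (cong (λ k → suc k % L) i≡m) (n%n≡0 L))

  -- rot e j is the (j+1)-st successor of e; for j = 0 … m it runs once around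
  -- the cycle, starting just after e and ending at e.
  rot : Fin L → ℕ → Fin L
  rot e zero    = next {m} e
  rot e (suc j) = next {m} (rot e j)

  module Rotation (e : Fin L) where

    K : ℕ
    K = m ∸ toℕ e

    e+K≡m : toℕ e + K ≡ m
    e+K≡m = m+[n∸m]≡n (toℕ≤m e)

    rot-before-wrap : ∀ j → toℕ e + j < m → toℕ (rot e j) ≡ suc (toℕ e + j)
    rot-before-wrap zero    lt = trans (next-step e (subst (_< m) (+-identityʳ _) lt))
                                       (cong suc (sym (+-identityʳ _)))
    rot-before-wrap (suc j) lt =
      trans (next-step (rot e j) (subst (_< m) (sym (trans IH (sym (+-suc _ j)))) lt))
            (cong suc (trans IH (sym (+-suc _ j))))
      where
      IH : toℕ (rot e j) ≡ suc (toℕ e + j)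
      IH = rot-before-wrap j (≤-trans (s≤s (+-monoʳ-≤ (toℕ e) (n≤1+n j))) lt)

    rot-wraps : ∀ j → toℕ e + j ≡ m → toℕ (rot e j) ≡ 0
    rot-wraps zero    eq = next-wrap e (trans (sym (+-identityʳ _)) eq)
    rot-wraps (suc j) eq = next-wrap (rot e j) (trans at-last eq)
      where
      at-last : toℕ (rot e j) ≡ toℕ e + suc j
      at-last = trans (rot-before-wrap j (subst (toℕ e + j <_) eq (subst (_≤ toℕ e + suc j)
                        (+-suc (toℕ e) j) ≤-refl))) (sym (+-suc (toℕ e) j))

    rot-after-wrap : ∀ d → d ≤ toℕ e → toℕ (rot e (K + d)) ≡ d
    rot-after-wrap zero    _  = rot-wraps (K + 0) (trans (cong (toℕ e +_) (+-identityʳ K)) e+K≡m)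
    rot-after-wrap (suc d) le rewrite +-suc K d =
      trans (next-step (rot e (K + d)) (subst (_< m) (sym IH) (<-≤-trans le (toℕ≤m e)))) (cong suc IH)
      where
      IH : toℕ (rot e (K + d)) ≡ d
      IH = rot-after-wrap d (≤-trans (n≤1+n d) le)

    rot-position : ∀ j → j ≤ m →
      (toℕ e < toℕ (rot e j) × toℕ (rot e j) ≡ suc (toℕ e + j)) ⊎
      (toℕ (rot e j) ≤ toℕ e × K + toℕ (rot e j) ≡ j)
    rot-position j j≤m with toℕ e + j <? m
    ... | yes lt = inj₁ (subst (toℕ e <_) (sym before) (s≤s (m≤m+n (toℕ e) j)) , before)
      where before = rot-before-wrap j lt
    ... | no ≮ = inj₂ (subst (_≤ toℕ e) (sym after) d≤e , cong (K +_) after ∙ sym j≡K+d)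
      where
      _∙_ = trans
      K≤j : K ≤ j
      K≤j = +-cancelˡ-≤ (toℕ e) K j (subst (_≤ toℕ e + j) (sym e+K≡m) (≮⇒≥ ≮))
      d = j ∸ K
      j≡K+d : j ≡ K + d
      j≡K+d = sym (m+[n∸m]≡n K≤j)
      d≤e : d ≤ toℕ e
      d≤e = +-cancelˡ-≤ K d (toℕ e) (subst₂ _≤_ j≡K+d (sym e+K≡m ∙ +-comm (toℕ e) K) j≤m)
      after : toℕ (rot e j) ≡ d
      after = subst (λ k → toℕ (rot e k) ≡ d) (sym j≡K+d) (rot-after-wrap d d≤e)

    rot-avoids-start : ∀ j → j < m → rot e j ≢ e
    rot-avoids-start j j<m eq with rot-position j (<⇒≤ j<m)
    ... | inj₁ (above , _) = <-irrefl (cong toℕ (sym eq)) above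
    ... | inj₂ (_ , K+e≡j) =
      <-irrefl (trans (sym K+e≡j) (trans (cong (K +_) (cong toℕ eq)) (trans (+-comm K _) e+K≡m))) j<m

    rot-injective : ∀ j j′ → j ≤ m → j′ ≤ m → rot e j ≡ rot e j′ → j ≡ j′
    rot-injective j j′ j≤m j′≤m eq with rot-position j j≤m | rot-position j′ j′≤m
    ... | inj₁ (_ , p) | inj₁ (_ , p′) =
      +-cancelˡ-≡ (toℕ e) j j′ (suc-injective (trans (sym p) (trans (cong toℕ eq) p′)))
    ... | inj₂ (_ , p) | inj₂ (_ , p′) = trans (sym p) (trans (cong (λ s → K + toℕ s) eq) p′)
    ... | inj₁ (above , _) | inj₂ (below , _) =
      ⊥-elim (<⇒≱ above (subst (λ s → toℕ s ≤ toℕ e) (sym eq) below))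
    ... | inj₂ (below , _) | inj₁ (above , _) =
      ⊥-elim (<⇒≱ above (subst (λ s → toℕ s ≤ toℕ e) eq below))

    rot-surjective : ∀ s → ∃ λ j → j ≤ m × rot e j ≡ s
    rot-surjective s with toℕ e <? toℕ s
    ... | yes e<s = j , j≤m , toℕ-injective (trans (rot-before-wrap j e+j<m) s≡1+e+j)
      where
      j = toℕ s ∸ suc (toℕ e)
      s≡1+e+j : suc (toℕ e + j) ≡ toℕ s
      s≡1+e+j = m+[n∸m]≡n e<s
      e+j<m : toℕ e + j < m
      e+j<m = subst (_≤ m) (sym s≡1+e+j) (toℕ≤m s)
      j≤m : j ≤ m
      j≤m = ≤-trans (m≤n+m j (toℕ e)) (<⇒≤ e+j<m)
    ... | no e≮s = K + toℕ s , j≤m , toℕ-injective (rot-after-wrap (toℕ s) s≤e)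
      where
      s≤e = ≮⇒≥ e≮s
      j≤m : K + toℕ s ≤ m
      j≤m = subst (K + toℕ s ≤_) (trans (+-comm K (toℕ e)) e+K≡m) (+-monoʳ-≤ K s≤e)

  next²-moves : 2 ≤ m → ∀ s → next {m} (next s) ≢ s
  next²-moves m≥2 s = Rotation.rot-avoids-start s 1 m≥2

module CycleDistance (m : ℕ) where
  open CycleIndex m

  cyc : Fin L → Fin L → ℕ
  cyc i j = cdist L (toℕ i) (toℕ j)

  D : ℕ
  D = ⌊ L /2⌋

  cyc-self : ∀ i → cyc i i ≡ 0
  cyc-self i = cong (λ d → d ⊓ (L ∸ d)) (∣n-n∣≡0 (toℕ i))

  cyc-sym : ∀ i j → cyc i j ≡ cyc j i
  cyc-sym i j = cdist-sym L (toℕ i) (toℕ j)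

  ∣-∣≤m : ∀ (i j : Fin L) → ∣ toℕ i - toℕ j ∣ ≤ m
  ∣-∣≤m i j = ≤-trans (∣m-n∣≤m⊔n (toℕ i) (toℕ j)) (⊔-lub (toℕ≤m i) (toℕ≤m j))

  cyc-pos : ∀ i j → i ≢ j → 1 ≤ cyc i j
  cyc-pos i j i≢j = ⊓-glb (n≢0⇒n>0 (λ eq → i≢j (toℕ-injective (∣m-n∣≡0⇒m≡n eq))))
                          (m<n⇒0<n∸m (s≤s (∣-∣≤m i j)))

  cyc-zero⇒≡ : ∀ i j → cyc i j ≡ 0 → i ≡ j
  cyc-zero⇒≡ i j eq with i ≟ᶠ j
  ... | yes i≡j = i≡j
  ... | no  i≢j = ⊥-elim (<-irrefl (sym eq) (cyc-pos i j i≢j))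

  cyc≤D : ∀ i j → cyc i j ≤ D
  cyc≤D i j = subst (_≤ D) (sym (n≡⌊n+n/2⌋ (cyc i j))) (⌊n/2⌋-mono twice≤L)
    where
    d = ∣ toℕ i - toℕ j ∣
    twice≤L : cyc i j + cyc i j ≤ L
    twice≤L = subst (cyc i j + cyc i j ≤_) (m+[n∸m]≡n (≤-trans (∣-∣≤m i j) (n≤1+n m)))
                    (+-mono-≤ (m⊓n≤m d (L ∸ d)) (m⊓n≤n d (L ∸ d)))

  next-isometry-at-wrap : ∀ i j → toℕ i ≡ m → toℕ j < m → cyc (next {m} i) (next j) ≡ cyc i j
  next-isometry-at-wrap i j i≡m j<m rewrite next-wrap i i≡m | next-step j j<m | i≡m =
    begin
      suc (toℕ j) ⊓ (m ∸ toℕ j)        ≡⟨ ⊓-comm (suc (toℕ j)) (m ∸ toℕ j) ⟩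
      (m ∸ toℕ j) ⊓ suc (toℕ j)        ≡⟨ cong ((m ∸ toℕ j) ⊓_) (sym L∸[m∸j]) ⟩
      (m ∸ toℕ j) ⊓ (L ∸ (m ∸ toℕ j))  ≡⟨ cong (λ d → d ⊓ (L ∸ d)) (sym (m≤n⇒∣n-m∣≡n∸m j≤m)) ⟩
      cdist L m (toℕ j)                ∎
    where
    open ≡-Reasoning
    j≤m = toℕ≤m j
    L∸[m∸j] : L ∸ (m ∸ toℕ j) ≡ suc (toℕ j)
    L∸[m∸j] = trans (+-∸-assoc 1 (m∸n≤m m (toℕ j))) (cong suc (m∸[m∸n]≡n j≤m))

  cyc-next-next : ∀ i j → cyc (next {m} i) (next j) ≡ cyc i j
  cyc-next-next i j with m≤n⇒m<n∨m≡n (toℕ≤m i) | m≤n⇒m<n∨m≡n (toℕ≤m j)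
  ... | inj₁ i<m | inj₁ j<m rewrite next-step i i<m | next-step j j<m = refl
  ... | inj₂ i≡m | inj₂ j≡m rewrite next-wrap i i≡m | next-wrap j j≡m =
    sym (trans (cong (λ k → cyc k j) (toℕ-injective (trans i≡m (sym j≡m)))) (cyc-self j))
  ... | inj₂ i≡m | inj₁ j<m = next-isometry-at-wrap i j i≡m j<m
  ... | inj₁ i<m | inj₂ j≡m =
    trans (cyc-sym (next i) (next j)) (trans (next-isometry-at-wrap j i j≡m i<m) (cyc-sym j i))

  cyc-next : 1 ≤ m → ∀ i j → cyc (next {m} i) j ≤ suc (cyc i j) × cyc i j ≤ suc (cyc (next i) j)
  cyc-next m≥1 i j with m≤n⇒m<n∨m≡n (toℕ≤m i)
  ... | inj₁ i<m rewrite next-step i i<m = cdist-suc L (toℕ i) (toℕ j)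
  ... | inj₂ i≡m = subst₂ (λ a b → a ≤ suc b) (cyc-next-next (next i) j) (cyc-next-next i j) up ,
                   subst₂ (λ a b → a ≤ suc b) (cyc-next-next i j) (cyc-next-next (next i) j) down
    where
    -- next i sits at position 0 < m, where 'next' does not wrap around
    0<m : toℕ (next {m} i) < m
    0<m = subst (_< m) (sym (next-wrap i i≡m)) m≥1
    up : cyc (next {m} (next i)) (next j) ≤ suc (cyc (next i) (next j))
    up = subst (λ a → cdist L a (toℕ (next j)) ≤ suc (cyc (next i) (next j)))
               (sym (next-step (next i) 0<m)) (proj₁ (cdist-suc L (toℕ (next i)) (toℕ (next j))))
    down : cyc (next {m} i) (next j) ≤ suc (cyc (next (next i)) (next j))
    down = subst (λ a → cyc (next i) (next j) ≤ suc (cdist L a (toℕ (next j))))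
                 (sym (next-step (next i) 0<m)) (proj₂ (cdist-suc L (toℕ (next i)) (toℕ (next j))))

  Isometry : (Fin L → Fin L) → Set
  Isometry f = ∀ i j → cyc (f i) (f j) ≡ cyc i j

  isometry-injective : ∀ {f} → Isometry f → ∀ {i j} → f i ≡ f j → i ≡ j
  isometry-injective {f} iso {i} {j} eq =
    cyc-zero⇒≡ i j (trans (sym (iso i j)) (trans (cong (λ k → cyc k (f j)) eq) (cyc-self (f j))))

  isometry-∘ : ∀ {f g} → Isometry f → Isometry g → Isometry (λ i → f (g i))
  isometry-∘ {g = g} iso-f iso-g i j = trans (iso-f (g i) (g j)) (iso-g i j)

  rot-isometry : ∀ k → Isometry (λ i → rot i k)
  rot-isometry zero    = cyc-next-next
  rot-isometry (suc k) i j = trans (cyc-next-next (rot i k) (rot j k)) (rot-isometry k i j)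

  opposite-isometry : Isometry opposite
  opposite-isometry i j =
    trans (cong₂ (cdist L) (opposite-prop i) (opposite-prop j))
          (cdist-reflect L m (toℕ i) (toℕ j) (toℕ≤m i) (toℕ≤m j))

  normalize : ∀ iu iv → cyc iu iv ≡ D →
              ∃ λ f → Isometry f × toℕ (f iu) ≡ 0 × toℕ (f iv) ≡ D
  normalize iu iv uv≡D = by-side (t ≤? L ∸ t)
    where
    -- first rotate iu to position 0; t is then the position of iv
    K : ℕ
    K = Rotation.K iu
    rotate : Fin L → Fin L
    rotate i = rot i K
    u↦0 : toℕ (rotate iu) ≡ 0
    u↦0 = Rotation.rot-wraps iu K (Rotation.e+K≡m iu)
    t : ℕ
    t = toℕ (rotate iv)
    t-dist : t ⊓ (L ∸ t) ≡ D
    t-dist = trans (cong (λ z → cdist L z t) (sym u↦0)) (trans (rot-isometry K iu iv) uv≡D)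
    by-side : Dec (t ≤ L ∸ t) → ∃ λ f → Isometry f × toℕ (f iu) ≡ 0 × toℕ (f iv) ≡ D
    by-side (yes t≤L∸t) = rotate , rot-isometry K , u↦0 , trans (sym (m≤n⇒m⊓n≡m t≤L∸t)) t-dist
    by-side (no  t≰L∸t) =
      reflect ,
      isometry-∘ {next} cyc-next-next (isometry-∘ {opposite} {rotate} opposite-isometry (rot-isometry K)) ,
      next-wrap (opposite (rotate iu)) (trans (opposite-prop (rotate iu)) (cong (m ∸_) u↦0)) ,
      v↦D
      where
      -- otherwise iv lies beyond D: reflect in the axis through position 0
      reflect : Fin L → Fin L
      reflect i = next {m} (opposite (rotate i))
      L∸t≡D : L ∸ t ≡ D
      L∸t≡D = trans (sym (m≥n⇒m⊓n≡n (<⇒≤ (≰⇒> t≰L∸t)))) t-dist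
      t≤m : t ≤ m
      t≤m = toℕ≤m (rotate iv)
      0<t : 0 < t
      0<t = n≢0⇒n>0 λ t≡0 → t≰L∸t (subst (λ z → z ≤ L ∸ z) (sym t≡0) z≤n)
      v↦D : toℕ (reflect iv) ≡ D
      v↦D = trans (next-step (opposite (rotate iv))
                           (subst (_< m) (sym (opposite-prop (rotate iv))) (∸-monoʳ-< 0<t t≤m)))
                  (trans (cong suc (opposite-prop (rotate iv))) (trans (sym (+-∸-assoc 1 t≤m)) L∸t≡D))

  ε : ℕ
  ε = proj₁ (halves L)

  module Frame = AntipodalFrame D ε (proj₁ (proj₂ (halves L))) L (proj₂ (proj₂ (halves L)))

  module Normalized (iu iv : Fin L) (antipodal : cyc iu iv ≡ D) where
    f : Fin L → Fin L
    f = proj₁ (normalize iu iv antipodal)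
    f-isometry : Isometry f
    f-isometry = proj₁ (proj₂ (normalize iu iv antipodal))
    position : Fin L → ℕ
    position t = toℕ (f t)
    u↦0 : position iu ≡ 0
    u↦0 = proj₁ (proj₂ (proj₂ (normalize iu iv antipodal)))
    v↦D : position iv ≡ D
    v↦D = proj₂ (proj₂ (proj₂ (normalize iu iv antipodal)))
    position-injective : ∀ {s t} → position s ≡ position t → s ≡ t
    position-injective eq = isometry-injective f-isometry (toℕ-injective eq)
    in-frame : ∀ x y {k} → position y ≡ k → cyc x y ≡ cdist L (position x) k
    in-frame x y y↦k = trans (sym (f-isometry x y)) (cong (cdist L (position x)) y↦k)
    to-u : ∀ t → cyc t iu ≡ cdist L (position t) 0
    to-u t = in-frame t iu u↦0
    to-v : ∀ t → cyc t iv ≡ cdist L (position t) D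
    to-v t = in-frame t iv v↦D

  antipodal-sum : ∀ iu iv → cyc iu iv ≡ D → ∀ t → cyc t iu + cyc t iv ≤ suc D
  antipodal-sum iu iv antipodal t =
    subst (_≤ suc D) (sym (cong₂ _+_ (to-u t) (to-v t)))
          (Frame.landmark-sum (position t) (toℕ<n (f t)))
    where open Normalized iu iv antipodal

  three-landmarks : ∀ iu iv iθ i j hx hy → cyc iu iv ≡ D → iθ ≢ iu → iθ ≢ iv →
                    i ≢ iu → i ≢ iv → j ≢ iu → j ≢ iv → i ≢ j →
                    hx + cyc i iu ≡ hy + cyc j iu → hx + cyc i iv ≡ hy + cyc j iv →
                    hx + cyc i iθ ≡ hy + cyc j iθ → ⊥
  three-landmarks iu iv iθ i j hx hy antipodal θ≢u θ≢v i≢u i≢v j≢u j≢v i≢j a-u a-v a-θ =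
    Frame.resolving (position i) (position j) (position iθ) hx hy
      (toℕ<n (f i)) (toℕ<n (f j)) (toℕ<n (f iθ))
      (off-u i≢u) (off-v i≢v) (off-u j≢u) (off-v j≢v) (λ eq → i≢j (position-injective eq))
      (off-u θ≢u) (off-v θ≢v)
      (in-frame′ to-u a-u) (in-frame′ to-v a-v) (in-frame′ (λ t → in-frame t iθ refl) a-θ)
    where
    open Normalized iu iv antipodal
    off-u : ∀ {t} → t ≢ iu → 1 ≤ position t
    off-u t≢u = n≢0⇒n>0 λ t↦0 → t≢u (position-injective (trans t↦0 (sym u↦0)))
    off-v : ∀ {t} → t ≢ iv → position t ≢ D
    off-v t≢v t↦D = t≢v (position-injective (trans t↦D (sym v↦D)))
    in-frame′ : ∀ {l k} → (∀ t → cyc t l ≡ cdist L (position t) k) →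
                hx + cyc i l ≡ hy + cyc j l → Frame.Agree hx hy (position i) (position j) k
    in-frame′ {l} frame agree = subst₂ (λ a b → hx + a ≡ hy + b) (frame i) (frame j) agree

no-closed-path : ∀ {n} {F : Graph n} → Acyclic F → (p : ℕ → Fin n) (K : ℕ) → 2 ≤ K →
                 (∀ j → j < K → F (p j) (p (suc j))) → F (p K) (p 0) →
                 (∀ j j′ → j < j′ → j′ ≤ K → p j ≢ p j′) → ⊥
no-closed-path {F = F} acyclic p K K≥2 adjacent closing distinct =
  acyclic K (λ i → p (toℕ i)) record { long = K≥2 ; inj = injective ; adj = adjacent′ }
  where
  open CycleIndex K using (toℕ≤m; next-step; next-wrap)
  injective : ∀ {i j} → p (toℕ i) ≡ p (toℕ j) → i ≡ j
  injective {i} {j} eq with <-cmp (toℕ i) (toℕ j)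
  ... | tri< i<j _ _ = ⊥-elim (distinct _ _ i<j (toℕ≤m j) eq)
  ... | tri≈ _ i≡j _ = toℕ-injective i≡j
  ... | tri> _ _ j<i = ⊥-elim (distinct _ _ j<i (toℕ≤m i) (sym eq))
  adjacent′ : ∀ i → F (p (toℕ i)) (p (toℕ (next i)))
  adjacent′ i with m≤n⇒m<n∨m≡n (toℕ≤m i)
  ... | inj₁ i<K = subst (λ k → F (p (toℕ i)) (p k)) (sym (next-step i i<K)) (adjacent _ i<K)
  ... | inj₂ i≡K = subst₂ (λ k l → F (p k) (p l)) (sym i≡K) (sym (next-wrap i i≡K)) closing

module Unicyclic {n : ℕ} (T : Graph n) (tree : IsTree T) (a b : Fin n)
                 (m : ℕ) (c : Fin (suc m) → Fin n) (cycle : IsCycle (AddEdge T a b) m c) where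
  open CycleIndex m public
  open CycleDistance m public
  open WalkOps

  G : Graph n
  G = AddEdge T a b

  H : Graph n
  H = RemoveCycleEdges G c

  m≥2 : 2 ≤ m
  m≥2 = IsCycle.long cycle

  m≥1 : 1 ≤ m
  m≥1 = ≤-trans (s≤s z≤n) m≥2

  c-injective : ∀ {i j} → c i ≡ c j → i ≡ j
  c-injective = IsCycle.inj cycle

  T-sym : ∀ {x y} → T x y → T y x
  T-sym = IsSimple.sym (IsTree.simple tree)

  G-sym : ∀ {x y} → G x y → G y x
  G-sym (inj₁ t)                = inj₁ (T-sym t)
  G-sym (inj₂ (inj₁ (p , q)))   = inj₂ (inj₂ (q , p))
  G-sym (inj₂ (inj₂ (p , q)))   = inj₂ (inj₁ (q , p))

  H-sym : ∀ {x y} → H x y → H y x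
  H-sym (g , not-cycle) = G-sym g , λ { (i , edge) → not-cycle (i , swap edge) }
    where
    swap : ∀ {A B : Set} → A ⊎ B → B ⊎ A
    swap (inj₁ x) = inj₂ x
    swap (inj₂ y) = inj₁ y

  AddedAt : Fin L → Set
  AddedAt s = (c s ≡ a × c (next s) ≡ b) ⊎ (c s ≡ b × c (next s) ≡ a)

  -- Since T is acyclic, the cycle uses the added edge …
  added-edge : ∃ AddedAt
  added-edge
    with any? (λ s → ((c s ≟ᶠ a) ×-dec (c (next s) ≟ᶠ b)) ⊎-dec
                     ((c s ≟ᶠ b) ×-dec (c (next s) ≟ᶠ a)))
  ... | yes found = found
  ... | no  none  = ⊥-elim (IsTree.acyclic tree m c record { long = m≥2 ; inj = c-injective ; adj = in-T })
    where
    in-T : ∀ s → T (c s) (c (next s))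
    in-T s with IsCycle.adj cycle s
    ... | inj₁ t     = t
    ... | inj₂ added = ⊥-elim (none (s , added))

  e : Fin L
  e = proj₁ added-edge

  -- … exactly once, as a cycle of length ≥ 3 does not traverse an edge twice.
  added-edge-unique : ∀ {s s′} → AddedAt s → AddedAt s′ → s ≡ s′
  added-edge-unique (inj₁ (p , q)) (inj₁ (p′ , q′)) = c-injective (trans p (sym p′))
  added-edge-unique (inj₂ (p , q)) (inj₂ (p′ , q′)) = c-injective (trans p (sym p′))
  added-edge-unique {s} (inj₁ (p , q)) (inj₂ (p′ , q′)) =
    ⊥-elim (next²-moves m≥2 s
             (trans (cong next (c-injective (trans q (sym p′)))) (c-injective (trans q′ (sym p)))))
  added-edge-unique {s′ = s′} (inj₂ (p , q)) (inj₁ (p′ , q′)) =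
    ⊥-elim (next²-moves m≥2 s′
             (trans (cong next (c-injective (trans q′ (sym p)))) (c-injective (trans q (sym p′)))))

  cycle-edge-in-T : ∀ s → s ≢ e → T (c s) (c (next s))
  cycle-edge-in-T s s≢e with IsCycle.adj cycle s
  ... | inj₁ t     = t
  ... | inj₂ added = ⊥-elim (s≢e (added-edge-unique added (proj₂ added-edge)))

  -- The hanging forest is part of the tree: ab itself is a cycle edge.
  H⇒T : ∀ {x y} → H x y → T x y
  H⇒T (inj₁ t , _) = t
  H⇒T (inj₂ ab , not-cycle) = ⊥-elim (not-cycle (e , at-e ab (proj₂ added-edge)))
    where
    at-e : ∀ {x y} → (x ≡ a × y ≡ b) ⊎ (x ≡ b × y ≡ a) → AddedAt e →
           (c e ≡ x × c (next e) ≡ y) ⊎ (c e ≡ y × c (next e) ≡ x)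
    at-e (inj₁ (x≡a , y≡b)) (inj₁ (p , q)) = inj₁ (trans p (sym x≡a) , trans q (sym y≡b))
    at-e (inj₁ (x≡a , y≡b)) (inj₂ (p , q)) = inj₂ (trans p (sym y≡b) , trans q (sym x≡a))
    at-e (inj₂ (x≡b , y≡a)) (inj₁ (p , q)) = inj₂ (trans p (sym y≡a) , trans q (sym x≡b))
    at-e (inj₂ (x≡b , y≡a)) (inj₂ (p , q)) = inj₁ (trans p (sym x≡b) , trans q (sym y≡a))

  -- Going once around the cycle, starting just after the added edge, gives
  -- the path q 0, q 1, …, q m of T.
  q : ℕ → Fin n
  q j = c (rot e j)

  q-path : ∀ j → j < m → T (q j) (q (suc j))
  q-path j j<m = cycle-edge-in-T (rot e j) (Rotation.rot-avoids-start e j j<m)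

  q-distinct : ∀ {j j′} → j ≤ m → j′ ≤ m → q j ≡ q j′ → j ≡ j′
  q-distinct j≤m j′≤m eq = Rotation.rot-injective e _ _ j≤m j′≤m (c-injective eq)

  Bridge : ℕ → Set
  Bridge k = ∃ λ i → ∃ λ t → i ≢ t × Walk H (c i) (c t) k

  -- A shortest bridge W from q β back to q α (α < β = α + 1 + d), followed
  -- by the path q α … q β, would be a cycle in the tree T.
  module ShortestBridge (α d : ℕ) (β≤m : suc α + d ≤ m) (k′ : ℕ)
                        (W : Walk H (q (suc α + d)) (q α) (suc k′))
                        (shortest : ∀ k → k < suc k′ → ¬ Bridge k) where

    β k : ℕ
    β = suc α + d
    k = suc k′

    α≤m : α ≤ m
    α≤m = ≤-trans (≤-trans (n≤1+n α) (m≤m+n (suc α) d)) β≤m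

    β≢α : rot e β ≢ rot e α
    β≢α eq = m≢1+m+n α (sym (Rotation.rot-injective e β α β≤m α≤m eq))

    -- By minimality W visits no vertex twice (cutting out a loop would give a
    -- shorter bridge) …
    bridge-distinct : ∀ j j′ → j < j′ → j′ ≤ k → vertexAt W j ≢ vertexAt W j′
    bridge-distinct j j′ j<j′ j′≤k eq =
      shortest _ shorter (rot e β , rot e α , β≢α , takeʷ W j (≤-trans (<⇒≤ j<j′) j′≤k) ++ʷ rest)
      where
      rest : Walk H (vertexAt W j) (q α) (k ∸ j′)
      rest = subst (λ z → Walk H z (q α) (k ∸ j′)) (sym eq) (dropʷ W j′ j′≤k)
      shorter : j + (k ∸ j′) < k
      shorter = subst (j + (k ∸ j′) <_) (m∸n+n≡m j′≤k)
                  (subst (_< (k ∸ j′) + j′) (+-comm (k ∸ j′) j) (+-monoʳ-< (k ∸ j′) j<j′))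

    -- … its interior avoids the cycle (else a part of it were a shorter bridge) …
    bridge-interior : ∀ j → 0 < j → j < k → ∀ s → vertexAt W j ≢ c s
    bridge-interior j 0<j j<k s eq with s ≟ᶠ rot e β
    ... | no  s≢β = shortest j j<k (rot e β , s , (λ β≡s → s≢β (sym β≡s)) ,
                      subst (λ z → Walk H (q β) z j) eq (takeʷ W j (<⇒≤ j<k)))
    ... | yes s≡β = shortest (k ∸ j) (∸-monoʳ-< 0<j (<⇒≤ j<k))
                      (s , rot e α , (λ s≡α → β≢α (trans (sym s≡β) s≡α)) ,
                       subst (λ z → Walk H z (q α) (k ∸ j)) eq (dropʷ W j (<⇒≤ j<k)))

    -- … and it is not the single cycle edge q α q (α + 1).
    not-a-cycle-edge : k′ ≡ 0 → d ≢ 0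
    not-a-cycle-edge k′≡0 d≡0 =
      proj₂ first-edge (rot e α , inj₂ (sym ends-at-α , cong (λ z → c (rot e (suc z))) (sym α+d≡α)))
      where
      first-edge : H (q β) (vertexAt W 1)
      first-edge = vertexAt-adjacent W 0 (s≤s z≤n)
      ends-at-α : vertexAt W 1 ≡ q α
      ends-at-α = trans (cong (vertexAt W) (cong suc (sym k′≡0))) (vertexAt-end W)
      α+d≡α : α + d ≡ α
      α+d≡α = trans (cong (α +_) d≡0) (+-identityʳ α)

    -- The closed sequence glue 0 … glue last: the path q α, …, q (α + d),
    -- then W from q β back to (just before) q α.
    glue : ℕ → Fin n
    glue j with j ≤? d
    ... | yes _ = q (α + j)
    ... | no  _ = vertexAt W (j ∸ suc d)

    glue-on-path : ∀ j → j ≤ suc d → glue j ≡ q (α + j)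
    glue-on-path j j≤1+d with j ≤? d
    ... | yes _   = refl
    ... | no  j≰d = begin
      vertexAt W (j ∸ suc d)    ≡⟨ cong (λ z → vertexAt W (z ∸ suc d)) j≡1+d ⟩
      vertexAt W (suc d ∸ suc d) ≡⟨ cong (vertexAt W) (n∸n≡0 (suc d)) ⟩
      q β                       ≡⟨ cong q (trans (sym (+-suc α d)) (cong (α +_) (sym j≡1+d))) ⟩
      q (α + j)                 ∎
      where
      open ≡-Reasoning
      j≡1+d : j ≡ suc d
      j≡1+d = ≤-antisym j≤1+d (≰⇒> j≰d)

    glue-on-bridge : ∀ i → glue (suc d + i) ≡ vertexAt W i
    glue-on-bridge i with suc d + i ≤? d
    ... | yes le = ⊥-elim (<⇒≱ (≤-trans (n<1+n d) (m≤m+n (suc d) i)) le)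
    ... | no  _  = cong (vertexAt W) (m+n∸m≡n (suc d) i)

    last : ℕ
    last = d + k

    last≡ : last ≡ suc d + k′
    last≡ = +-suc d k′

    -- Consecutive entries are adjacent in T (path edges, and H-edges of W) …
    glue-adjacent : ∀ j → j < last → T (glue j) (glue (suc j))
    glue-adjacent j j<last = by-cases (j ≤? d)
      where
      by-cases : Dec (j ≤ d) → T (glue j) (glue (suc j))
      by-cases (yes j≤d) =
        subst₂ T (sym (glue-on-path j (m≤n⇒m≤1+n j≤d))) (sym (glue-on-path (suc j) (s≤s j≤d)))
          (subst (λ z → T (q (α + j)) (q z)) (sym (+-suc α j))
            (q-path (α + j) (≤-trans (s≤s (+-monoʳ-≤ α j≤d)) β≤m)))
      by-cases (no j≰d) =
        subst₂ T (trans (sym (glue-on-bridge i)) (cong glue j≡))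
                 (trans (sym (glue-on-bridge (suc i))) (cong glue (trans (+-suc (suc d) i) (cong suc j≡))))
                 (H⇒T (vertexAt-adjacent W i i<k))
        where
        i : ℕ
        i = j ∸ suc d
        j≡ : suc d + i ≡ j
        j≡ = m+[n∸m]≡n (≰⇒> j≰d)
        i<k : i < k
        i<k = m<n⇒m<1+n (+-cancelˡ-< (suc d) i k′ (subst₂ _<_ (sym j≡) last≡ j<last))

    -- … and so are the last and the first one, by the last edge of W …
    glue-closes : T (glue last) (glue 0)
    glue-closes = subst₂ T (sym (trans (cong glue last≡) (glue-on-bridge k′)))
                           (sym (trans (glue-on-path 0 z≤n) (cong q (+-identityʳ α))))
                    (subst (T (vertexAt W k′)) (vertexAt-end W) (H⇒T (vertexAt-adjacent W k′ ≤-refl)))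

    2≤last : 2 ≤ last
    2≤last with k′ ≟ 0 | d ≟ 0
    ... | no  k′≢0 | _       = ≤-trans (s≤s (n≢0⇒n>0 k′≢0)) (m≤n+m (suc k′) d)
    ... | yes _    | no  d≢0 = +-mono-≤ (n≢0⇒n>0 d≢0) (s≤s z≤n)
    ... | yes k′≡0 | yes d≡0 = ⊥-elim (not-a-cycle-edge k′≡0 d≡0)

    data Position (j : ℕ) : Set where
      on-path   : j ≤ suc d → Position j
      in-bridge : ∀ i → suc d + suc i ≡ j → Position j

    position : ∀ j → Position j
    position j with j ≤? suc d
    ... | yes j≤1+d = on-path j≤1+d
    ... | no  j≰1+d = in-bridge (j ∸ suc (suc d)) (trans (+-suc (suc d) _) (m+[n∸m]≡n (≰⇒> j≰1+d)))

    glue-distinct : ∀ j j′ → j < j′ → j′ ≤ last → glue j ≢ glue j′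
    glue-distinct j j′ j<j′ j′≤last eq with position j | position j′
    ... | on-path j≤ | on-path j′≤ =
      <-irrefl (+-cancelˡ-≡ α _ _ (q-distinct (within j≤) (within j′≤)
                 (trans (sym (glue-on-path j j≤)) (trans eq (glue-on-path j′ j′≤))))) j<j′
      where
      within : ∀ {z} → z ≤ suc d → α + z ≤ m
      within z≤ = ≤-trans (+-monoʳ-≤ α z≤) (subst (_≤ m) (sym (+-suc α d)) β≤m)
    ... | on-path j≤ | in-bridge i′ refl =
      bridge-interior (suc i′) (s≤s z≤n) (s≤s i′<k′) (rot e (α + j))
        (trans (sym (glue-on-bridge (suc i′))) (trans (sym eq) (glue-on-path j j≤)))
      where
      i′<k′ : suc i′ ≤ k′
      i′<k′ = +-cancelˡ-≤ (suc d) (suc i′) k′ (subst (suc d + suc i′ ≤_) last≡ j′≤last)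
    ... | in-bridge i refl | on-path j′≤ =
      <⇒≱ j<j′ (≤-trans j′≤ (m≤m+n (suc d) (suc i)))
    ... | in-bridge i refl | in-bridge i′ refl =
      bridge-distinct (suc i) (suc i′) (+-cancelˡ-< (suc d) _ _ j<j′)
        (m≤n⇒m≤1+n (+-cancelˡ-≤ (suc d) (suc i′) k′ (subst (suc d + suc i′ ≤_) last≡ j′≤last)))
        (trans (sym (glue-on-bridge (suc i))) (trans eq (glue-on-bridge (suc i′))))

    contradiction : ⊥
    contradiction =
      no-closed-path (IsTree.acyclic tree) glue last 2≤last glue-adjacent glue-closes glue-distinct

  no-shortest-bridge : ∀ α β → α < β → β ≤ m → ∀ k → Walk H (q β) (q α) k →
                       (∀ k′ → k′ < k → ¬ Bridge k′) → ⊥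
  no-shortest-bridge α β α<β β≤m zero    W _ =
    <-irrefl (sym (q-distinct β≤m (≤-trans (<⇒≤ α<β) β≤m) (vertexAt-end W))) α<β
  no-shortest-bridge α β α<β β≤m (suc k′) W shortest =
    ShortestBridge.contradiction α d (subst (_≤ m) (sym β≡) β≤m) k′
      (subst (λ z → Walk H (q z) (q α) (suc k′)) (sym β≡) W) shortest
    where
    d : ℕ
    d = β ∸ suc α
    β≡ : suc α + d ≡ β
    β≡ = m+[n∸m]≡n α<β

  no-bridge : ∀ k → ¬ Bridge k
  no-bridge k bridge = refute-minimal Bridge bridge shortest-case
    where
    shortest-case : ∀ k → Bridge k → (∀ k′ → k′ < k → ¬ Bridge k′) → ⊥
    shortest-case k (i , t , i≢t , W) shortest
      with Rotation.rot-surjective e i | Rotation.rot-surjective e t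
    ... | α , α≤m , rot-α≡i | β , β≤m , rot-β≡t with <-cmp α β
    ... | tri≈ _ α≡β _ = i≢t (trans (sym rot-α≡i) (trans (cong (rot e) α≡β) rot-β≡t))
    ... | tri< α<β _ _ = no-shortest-bridge α β α<β β≤m k
                           (subst₂ (λ x y → Walk H x y k) (cong c (sym rot-β≡t)) (cong c (sym rot-α≡i))
                                   (reverseʷ H-sym W))
                           shortest
    ... | tri> _ _ β<α = no-shortest-bridge β α β<α α≤m k
                           (subst₂ (λ x y → Walk H x y k) (cong c (sym rot-α≡i)) (cong c (sym rot-β≡t)) W)
                           shortest

  hanging-subtrees-disjoint : ∀ i t → Reach H (c i) (c t) → i ≡ t
  hanging-subtrees-disjoint i t (k , W) with i ≟ᶠ t
  ... | yes i≡t = i≡t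
  ... | no  i≢t = ⊥-elim (no-bridge k (i , t , i≢t , W))

around-length : ∀ M i j → i ≤ j → j ≤ M → (M ∸ j) + suc i ≡ suc M ∸ (j ∸ i)
around-length M       zero    j       _         j≤M       =
  trans (+-comm (M ∸ j) 1) (sym (+-∸-assoc 1 j≤M))
around-length (suc M) (suc i) (suc j) (s≤s i≤j) (s≤s j≤M) =
  trans (+-suc (M ∸ j) (suc i)) (trans (cong suc (around-length M i j i≤j j≤M))
        (sym (+-∸-assoc 1 (≤-trans (m∸n≤m j i) (≤-trans j≤M (n≤1+n M))))))

module Distances {n : ℕ} (T : Graph n) (tree : IsTree T) (a b : Fin n)
                 (m : ℕ) (c : Fin (suc m) → Fin n) (cycle : IsCycle (AddEdge T a b) m c) where
  open Unicyclic T tree a b m c cycle public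
  open WalkOps

  walk-forward : ∀ d i j → toℕ j ≡ toℕ i + d → Walk G (c i) (c j) d
  walk-forward zero    i j j≡i =
    subst (λ z → Walk G (c i) (c z) 0) (toℕ-injective (trans (sym (+-identityʳ _)) (sym j≡i))) here
  walk-forward (suc d) i j j≡i+1+d = step (IsCycle.adj cycle i) (walk-forward d (next i) j j≡next+d)
    where
    i<m : toℕ i < m
    i<m = ≤-trans (s≤s (m≤m+n (toℕ i) d)) (subst (_≤ m) (trans j≡i+1+d (+-suc (toℕ i) d)) (toℕ≤m j))
    j≡next+d : toℕ j ≡ toℕ (next {m} i) + d
    j≡next+d = trans j≡i+1+d (trans (+-suc (toℕ i) d) (cong (_+ d) (sym (next-step i i<m))))

  walk-around : ∀ i j → toℕ i ≤ toℕ j → Walk G (c j) (c i) (L ∸ (toℕ j ∸ toℕ i))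
  walk-around i j i≤j = subst (Walk G (c j) (c i)) (around-length m (toℕ i) (toℕ j) i≤j (toℕ≤m j))
    (walk-forward (m ∸ toℕ j) j last (trans (toℕ-fromℕ m) (sym (m+[n∸m]≡n (toℕ≤m j))))
     ++ʷ step (subst (λ z → G (c last) (c z)) last↦0 (IsCycle.adj cycle last))
              (walk-forward (toℕ i) zero i refl))
    where
    last : Fin L
    last = fromℕ m
    last↦0 : next last ≡ zero
    last↦0 = toℕ-injective (next-wrap last (toℕ-fromℕ m))

  -- The cycle contains a walk of length cyc i j from c i to c j: the direct
  -- one or the one around, whichever is shorter.
  walk-cyc-ordered : ∀ i j → toℕ i ≤ toℕ j → Walk G (c i) (c j) (cyc i j)
  walk-cyc-ordered i j i≤j with ∣ toℕ i - toℕ j ∣ ≤? L ∸ ∣ toℕ i - toℕ j ∣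
  ... | yes short = subst (Walk G (c i) (c j)) (sym (trans (m≤n⇒m⊓n≡m short) gap))
                          (walk-forward (toℕ j ∸ toℕ i) i j (sym (m+[n∸m]≡n i≤j)))
    where gap = m≤n⇒∣m-n∣≡n∸m i≤j
  ... | no  long  = subst (Walk G (c i) (c j))
                          (sym (trans (m≥n⇒m⊓n≡n (<⇒≤ (≰⇒> long))) (cong (L ∸_) gap)))
                          (reverseʷ G-sym (walk-around i j i≤j))
    where gap = m≤n⇒∣m-n∣≡n∸m i≤j

  walk-cyc : ∀ i j → Walk G (c i) (c j) (cyc i j)
  walk-cyc i j with toℕ i ≤? toℕ j
  ... | yes i≤j = walk-cyc-ordered i j i≤j
  ... | no  i≰j = subst (Walk G (c i) (c j)) (cyc-sym j i)
                        (reverseʷ G-sym (walk-cyc-ordered j i (<⇒≤ (≰⇒> i≰j))))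

  Hangs : Fin n → Fin n → Set
  Hangs w x = InSubtree G c w x

  hangs-step : ∀ {w x y} → Hangs w x → H x y → Hangs w y
  hangs-step (k , w↝x) h = k + 1 , (w↝x ++ʷ step h here)

  with-height : ∀ {w x} → Hangs w x → (∀ h → Dist G x w h → ⊥) → ⊥
  with-height (k , w↝x) = refute-with-dist (reverseʷ G-sym (mapʷ proj₁ w↝x))

  cycle-edge? : ∀ x y → Dec (CycleEdge c x y)
  cycle-edge? x y =
    any? λ i → ((c i ≟ᶠ x) ×-dec (c (next i) ≟ᶠ y)) ⊎-dec ((c i ≟ᶠ y) ×-dec (c (next i) ≟ᶠ x))

  leave-along-cycle : ∀ {x x₁} i j → Hangs (c i) x → CycleEdge c x x₁ →
                      ∃ λ i′ → x ≡ c i × x₁ ≡ c i′ × cyc i j ≤ suc (cyc i′ j)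
  leave-along-cycle {x} i j i↝x (s , inj₁ (cs≡x , c[next-s]≡x₁)) =
    next s , trans (sym cs≡x) (cong c (sym i≡s)) , sym c[next-s]≡x₁ ,
    subst (λ z → cyc z j ≤ suc (cyc (next s) j)) (sym i≡s) (proj₂ (cyc-next m≥1 s j))
    where
    i≡s : i ≡ s
    i≡s = hanging-subtrees-disjoint i s (subst (Hangs (c i)) (sym cs≡x) i↝x)
  leave-along-cycle {x} i j i↝x (s , inj₂ (cs≡x₁ , c[next-s]≡x)) =
    s , trans (sym c[next-s]≡x) (cong c (sym i≡next-s)) , sym cs≡x₁ ,
    subst (λ z → cyc z j ≤ suc (cyc s j)) (sym i≡next-s) (proj₁ (cyc-next m≥1 s j))
    where
    i≡next-s : i ≡ next s
    i≡next-s = hanging-subtrees-disjoint i (next s) (subst (Hangs (c i)) (sym c[next-s]≡x) i↝x)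

  Decomposition : Fin n → Fin n → ℕ → Fin L → Fin L → Set
  Decomposition x z k i j =
    ∃ λ p → ∃ λ r → Walk G x (c i) p × Walk G (c j) z r × p + cyc i j + r ≤ k

  walk-decomposes : ∀ {x z k} → Walk G x z k → ∀ i j → i ≢ j → Hangs (c i) x → Hangs (c j) z →
                    Decomposition x z k i j
  walk-decomposes here i j i≢j i↝x j↝z =
    ⊥-elim (i≢j (hanging-subtrees-disjoint i j (join i↝x j↝z)))
    where
    join : ∀ {v w x} → Hangs v x → Hangs w x → Hangs v w
    join (k , v↝x) (l , w↝x) = k + l , (v↝x ++ʷ reverseʷ H-sym w↝x)
  walk-decomposes (step {z = x₁} g rest) i j i≢j i↝x j↝z with cycle-edge? _ x₁
  ... | no not-cycle with walk-decomposes rest i j i≢j (hangs-step i↝x (g , not-cycle)) j↝z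
  ...   | p , r , x₁↝ci , cj↝z , bound = suc p , r , step g x₁↝ci , cj↝z , s≤s bound
  walk-decomposes {x} {z} (step {z = x₁} {k = k′} g rest) i j i≢j i↝x j↝z | yes edge
    with leave-along-cycle i j i↝x edge
  ... | i′ , x≡ci , x₁≡ci′ , closer with i′ ≟ᶠ j
  ...   | yes i′≡j =
    0 , k′ , subst (λ y → Walk G y (c i) 0) (sym x≡ci) here ,
    subst (λ y → Walk G y z k′) (trans x₁≡ci′ (cong c i′≡j)) rest ,
    +-monoˡ-≤ k′ (subst (λ t → cyc i j ≤ suc t) (trans (cong (λ t → cyc t j) i′≡j) (cyc-self j)) closer)
  ...   | no  i′≢j
    with walk-decomposes rest i′ j i′≢j (0 , subst (λ y → Walk H (c i′) y 0) (sym x₁≡ci′) here) j↝z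
  ...     | p′ , r , _ , cj↝z , bound =
    0 , r , subst (λ y → Walk G y (c i) 0) (sym x≡ci) here , cj↝z ,
    ≤-trans (+-monoˡ-≤ r closer) (s≤s (≤-trans (+-monoˡ-≤ r (m≤n+m (cyc i′ j) p′)) bound))

  dist-cyc : ∀ i j → Dist G (c i) (c j) (cyc i j)
  dist-cyc i j = walk-cyc i j , no-shorter
    where
    no-shorter : ∀ l → l < cyc i j → ¬ Walk G (c i) (c j) l
    no-shorter l l<cyc w with i ≟ᶠ j
    ... | yes refl = <⇒≱ l<cyc (subst (_≤ l) (sym (cyc-self i)) z≤n)
    ... | no  i≢j with walk-decomposes w i j i≢j (0 , here) (0 , here)
    ...   | p , r , _ , _ , bound =
      <⇒≱ l<cyc (≤-trans (≤-trans (m≤n+m (cyc i j) p) (m≤m+n (p + cyc i j) r)) bound)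

  cyc-triangle : ∀ i j k → cyc i j ≤ cyc i k + cyc k j
  cyc-triangle i j k = dist-minimal (dist-cyc i j) (walk-cyc i k ++ʷ walk-cyc k j)

  DistanceFormula : Fin L → Fin L → ℕ → ℕ → ℕ → Set
  DistanceFormula i l hx hs k = (i ≢ l → k ≡ hx + cyc i l + hs) × (i ≡ l → k ≤ hx + hs)

  distance-formula : ∀ {x s} i l {hx hs k} → Hangs (c i) x → Hangs (c l) s →
                     Dist G x (c i) hx → Dist G s (c l) hs → Dist G x s k → DistanceFormula i l hx hs k
  distance-formula {x} {s} i l {hx} {hs} {k} i↝x l↝s x-height s-height x-to-s = across , within
    where
    across : i ≢ l → k ≡ hx + cyc i l + hs
    across i≢l with walk-decomposes (proj₁ x-to-s) i l i≢l i↝x l↝s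
    ... | p , r , up , down , bound =
      ≤-antisym (subst (k ≤_) (sym (+-assoc hx (cyc i l) hs))
                       (dist-minimal x-to-s
                          (proj₁ x-height ++ʷ (walk-cyc i l ++ʷ reverseʷ G-sym (proj₁ s-height)))))
                (≤-trans (+-mono-≤ (+-monoˡ-≤ (cyc i l) (dist-minimal x-height up))
                                   (dist-minimal s-height (reverseʷ G-sym down))) bound)
    within : i ≡ l → k ≤ hx + hs
    within refl = dist-minimal x-to-s (proj₁ x-height ++ʷ reverseʷ G-sym (proj₁ s-height))

module Resolution {n : ℕ} (T : Graph n) (tree : IsTree T) (a b : Fin n)
                  (m : ℕ) (c : Fin (suc m) → Fin n) (cycle : IsCycle (AddEdge T a b) m c) where
  open Distances T tree a b m c cycle public

  record Tie (i j : Fin L) (hx hy : ℕ) (l : Fin L) (h : ℕ) : Set where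
    constructor tie
    field
      distance : ℕ
      from-x   : DistanceFormula i l hx h distance
      from-y   : DistanceFormula j l hy h distance

  tie-from : ∀ {x y s i j l hx hy h k} → Hangs (c i) x → Hangs (c j) y →
             Dist G x (c i) hx → Dist G y (c j) hy → Hangs (c l) s → Dist G s (c l) h →
             Dist G x s k → Dist G y s k → Tie i j hx hy l h
  tie-from {i = i} {j} {l} x-hangs y-hangs x-height y-height s-hangs s-height x-to-s y-to-s =
    tie _ (distance-formula i l x-hangs s-hangs x-height s-height x-to-s)
          (distance-formula j l y-hangs s-hangs y-height s-height y-to-s)

  tie-sym : ∀ {i j hx hy l h} → Tie i j hx hy l h → Tie j i hy hx l h
  tie-sym (tie k from-x from-y) = tie k from-y from-x

  tie-across : ∀ {i j hx hy l h} → Tie i j hx hy l h → i ≢ l → j ≢ l → hx + cyc i l ≡ hy + cyc j l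
  tie-across {h = h} (tie k from-x from-y) i≢l j≢l =
    +-cancelʳ-≡ h _ _ (trans (sym (proj₁ from-x i≢l)) (proj₁ from-y j≢l))

  tie-within : ∀ {i j hx hy h} → Tie i j hx hy i h → j ≢ i → hy + cyc j i ≤ hx
  tie-within {hx = hx} {h = h} (tie k from-x from-y) j≢i =
    +-cancelʳ-≤ h _ _ (subst (_≤ hx + h) (proj₁ from-y j≢i) (proj₂ from-x refl))

  tie-at-antipodal-root : ∀ i j iv hx hy hu hv → i ≢ j → i ≢ iv → cyc i iv ≡ D →
                          Tie i j hx hy i hu → Tie i j hx hy iv hv → ⊥
  tie-at-antipodal-root i j iv hx hy hu hv i≢j i≢v antipodal tie-u tie-v@(tie k from-x from-y) with j ≟ᶠ iv
  ... | yes refl =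
    <-irrefl refl (<-≤-trans (m<m+n hx 1≤D) (≤-trans x-below-y (≤-trans (m≤m+n hy D) y-below-x)))
    where
    -- y hangs from the other landmark root: each is D higher than the other
    1≤D : 1 ≤ D
    1≤D = subst (1 ≤_) antipodal (cyc-pos i j i≢j)
    x-below-y : hx + D ≤ hy
    x-below-y = +-cancelʳ-≤ hv _ _
                  (subst (_≤ hy + hv) (trans (proj₁ from-x i≢v) (cong (λ d → hx + d + hv) antipodal))
                         (proj₂ from-y refl))
    y-below-x : hy + D ≤ hx
    y-below-x = subst (λ d → hy + d ≤ hx) (trans (cyc-sym j i) antipodal) (tie-within tie-u (≢-sym i≢j))
  ... | no j≢v = <-irrefl refl (≤-<-trans x≤y y<x)
    where
    -- otherwise the landmark in T_{c iv} shows hx + D ≤ hy + cyc j iv ≤ hy + D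
    x≤y : hx ≤ hy
    x≤y = +-cancelʳ-≤ D _ _
            (subst (_≤ hy + D) (sym (trans (cong (hx +_) (sym antipodal)) (tie-across tie-v i≢v j≢v)))
                   (+-monoʳ-≤ hy (cyc≤D j iv)))
    y<x : hy < hx
    y<x = <-≤-trans (m<m+n hy (cyc-pos j i (≢-sym i≢j))) (tie-within tie-u (≢-sym i≢j))

  -- … nor from the third one while y hangs off all landmark roots: x is then
  -- higher than y by at least g = cyc j i ≥ 1, so i is closer than j to iu
  -- and to iv by g each; but j is within D + 1 of both together (antipodal
  -- sum) and i at least D (triangle inequality), forcing 2g ≤ 1.
  tie-at-third-root : ∀ i j iu iv hx hy hu hv hθ → i ≢ j → i ≢ iu → i ≢ iv → j ≢ iu → j ≢ iv →
                      cyc iu iv ≡ D → Tie i j hx hy iu hu → Tie i j hx hy iv hv → Tie i j hx hy i hθ → ⊥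
  tie-at-third-root i j iu iv hx hy hu hv hθ i≢j i≢u i≢v j≢u j≢v antipodal tie-u tie-v tie-θ =
    <⇒≱ (+-monoˡ-< (cyc i iu + cyc i iv) (+-mono-≤ 1≤g 1≤g)) (≤-trans twice-g (s≤s D≤))
    where
    g : ℕ
    g = cyc j i
    1≤g : 1 ≤ g
    1≤g = cyc-pos j i (≢-sym i≢j)
    y-below-x : hy + g ≤ hx
    y-below-x = tie-within tie-θ (≢-sym i≢j)
    gap : ∀ {a a′} → hx + a ≡ hy + a′ → g + a ≤ a′
    gap {a} {a′} eq = +-cancelˡ-≤ hy _ _ (subst (_≤ hy + a′) (+-assoc hy g a)
                        (subst (hy + g + a ≤_) eq (+-monoˡ-≤ a y-below-x)))
    D≤ : D ≤ cyc i iu + cyc i iv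
    D≤ = subst₂ _≤_ antipodal (cong (_+ cyc i iv) (cyc-sym iu i)) (cyc-triangle iu iv i)
    twice-g : (g + g) + (cyc i iu + cyc i iv) ≤ suc D
    twice-g = subst (_≤ suc D) (rearrange g (cyc i iu) (cyc i iv))
                (≤-trans (+-mono-≤ (gap (tie-across tie-u i≢u j≢u)) (gap (tie-across tie-v i≢v j≢v)))
                         (antipodal-sum iu iv antipodal j))
      where
      rearrange : ∀ g a b → (g + a) + (g + b) ≡ (g + g) + (a + b)
      rearrange = solve-∀

  landmarks-resolve : ∀ i j iu iv iθ hx hy hu hv hθ → i ≢ j → iu ≢ iv → iu ≢ iθ → iv ≢ iθ →
                      cyc iu iv ≡ D → Tie i j hx hy iu hu → Tie i j hx hy iv hv → Tie i j hx hy iθ hθ → ⊥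
  landmarks-resolve i j iu iv iθ hx hy hu hv hθ i≢j u≢v u≢θ v≢θ antipodal tie-u tie-v tie-θ
    with i ≟ᶠ iu | i ≟ᶠ iv | j ≟ᶠ iu | j ≟ᶠ iv
  ... | yes refl | _ | _ | _ = tie-at-antipodal-root i j iv hx hy hu hv i≢j u≢v antipodal tie-u tie-v
  ... | no _ | yes refl | _ | _ =
    tie-at-antipodal-root i j iu hx hy hv hu i≢j (≢-sym u≢v) antipodal′ tie-v tie-u
    where antipodal′ = trans (cyc-sym iv iu) antipodal
  ... | no _ | no _ | yes refl | _ =
    tie-at-antipodal-root j i iv hy hx hu hv (≢-sym i≢j) u≢v antipodal (tie-sym tie-u) (tie-sym tie-v)
  ... | no _ | no _ | no _ | yes refl =
    tie-at-antipodal-root j i iu hy hx hv hu (≢-sym i≢j) (≢-sym u≢v) antipodal′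
      (tie-sym tie-v) (tie-sym tie-u)
    where antipodal′ = trans (cyc-sym iv iu) antipodal
  ... | no i≢u | no i≢v | no j≢u | no j≢v with i ≟ᶠ iθ | j ≟ᶠ iθ
  ...   | yes refl | _ =
    tie-at-third-root i j iu iv hx hy hu hv hθ i≢j i≢u i≢v j≢u j≢v antipodal tie-u tie-v tie-θ
  ...   | no _ | yes refl =
    tie-at-third-root j i iu iv hy hx hu hv hθ (≢-sym i≢j) j≢u j≢v i≢u i≢v antipodal
      (tie-sym tie-u) (tie-sym tie-v) (tie-sym tie-θ)
  ...   | no i≢θ | no j≢θ =
    three-landmarks iu iv iθ i j hx hy antipodal (≢-sym u≢θ) (≢-sym v≢θ) i≢u i≢v j≢u j≢v i≢j
      (tie-across tie-u i≢u j≢u) (tie-across tie-v i≢v j≢v) (tie-across tie-θ i≢θ j≢θ)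

lemma4p1 : (n : ℕ) (T : Graph n) → IsTree T →
    (a b : Fin n) → a ≢ b → ¬ T a b →
    (m : ℕ) (c : Fin (suc m) → Fin n) → IsCycle (AddEdge T a b) m c →
    (u₀ v₀ θ₀ : Fin n) → OnCycle c u₀ → OnCycle c v₀ → OnCycle c θ₀ →
    u₀ ≢ v₀ → u₀ ≢ θ₀ → v₀ ≢ θ₀ →
    Dist (AddEdge T a b) u₀ v₀ (diamC m) →
    (u v θ : Fin n) →
    InSubtree (AddEdge T a b) c u₀ u →
    InSubtree (AddEdge T a b) c v₀ v →
    InSubtree (AddEdge T a b) c θ₀ θ →
    (w w′ x y : Fin n) → OnCycle c w → OnCycle c w′ →
    InSubtree (AddEdge T a b) c w x → InSubtree (AddEdge T a b) c w′ y →
    ¬ (∀ z → (InSubtree (AddEdge T a b) c w z → InSubtree (AddEdge T a b) c w′ z)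
           × (InSubtree (AddEdge T a b) c w′ z → InSubtree (AddEdge T a b) c w z)) →
    (k₁ k₂ k₃ : ℕ) →
    ¬ (Dist (AddEdge T a b) x u k₁ × Dist (AddEdge T a b) y u k₁ ×
       Dist (AddEdge T a b) x v k₂ × Dist (AddEdge T a b) y v k₂ ×
       Dist (AddEdge T a b) x θ k₃ × Dist (AddEdge T a b) y θ k₃)
lemma4p1 n T tree a b _ _ m c cycle u₀ v₀ θ₀ (iu , refl) (iv , refl) (iθ , refl) u₀≢v₀ u₀≢θ₀ v₀≢θ₀
         diameter u v θ u-hangs v-hangs θ-hangs w w′ x y (i , refl) (j , refl) x-hangs y-hangs
         different-subtrees k₁ k₂ k₃ (xu , yu , xv , yv , xθ , yθ) =
  with-height x-hangs λ hx x-height → with-height y-hangs λ hy y-height →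
  with-height u-hangs λ hu u-height → with-height v-hangs λ hv v-height →
  with-height θ-hangs λ hθ θ-height →
  landmarks-resolve i j iu iv iθ hx hy hu hv hθ i≢j
    (distinct u₀≢v₀) (distinct u₀≢θ₀) (distinct v₀≢θ₀) (dist-unique (dist-cyc iu iv) diameter)
    (tie-from x-hangs y-hangs x-height y-height u-hangs u-height xu yu)
    (tie-from x-hangs y-hangs x-height y-height v-hangs v-height xv yv)
    (tie-from x-hangs y-hangs x-height y-height θ-hangs θ-height xθ yθ)
  where
  open Resolution T tree a b m c cycle
  open WalkOps
  distinct : ∀ {s t} → c s ≢ c t → s ≢ t
  distinct c-s≢c-t s≡t = c-s≢c-t (cong c s≡t)
  i≢j : i ≢ j
  i≢j refl = different-subtrees λ z → (λ h → h) , (λ h → h)
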